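{- Let $k\ge1$ and $n\ge 2k+1$. The restriction of $f$ to $\mathcal V_n^{k,+}$ is a bijection $f:\mathcal V_n^{k,+}\to\mathcal V_{n-2}^{k-1}$, and $g_n$ is its inverse. Furthermore, if $X,Y\in\mathcal V_n^{k}$ are disjoint then $f(X)$ and $f(Y)$ are disjoint.
   Context: $\mathcal V_p^j$ denotes the set of $j$-element subsets of $[p]=\{1,\dots,p\}$ independent in the cycle $C_p$ (no two elements cyclically consecutive, $p$ and $1$ being consecutive). For $A\in\mathcal V_n^k$, $\mathrm{core}(A)=A\setminus\{1\}$ if $1\in A$ and $\mathrm{core}(A)=A\setminus\{\max A\}$ otherwise; $\mathrm{core}(A)$ contains neither $1$ nor $n$. For a set $S$ of integers, $S-1=\{s-1:s\in S\}$ and $S+1=\{s+1:s\in S\}$. Define $f(X)=\mathrm{core}(X)-1$ for $X\in\mathcal V_n^k$, and for $Y\in\mathcal V_{n-2}^{k-1}$ define $g_n(Y)=(Y+1)\cup\{1\}$ if $n-2\in Y$ and $g_n(Y)=(Y+1)\cup\{n\}$ otherwise. For $0\le i\le n/2$ let $\Lambda_{n,i}=\{2,4,\dots,i-1\}\cup\{n-i+1,n-i+3,\dots,n\}$ if $i$ is odd and $\Lambda_{n,i}=\{1,3,\dots,i-1\}\cup\{n-i+1,n-i+3,\dots,n-1\}$ if $i$ is even; the $n$-level $\ell_n(A)$ of $A\in\mathcal V_n^k$ is the largest $i$ with $\Lambda_{n,i}\subseteq A$. Let $\mathcal V_n^{k,+}=\{A\in\mathcal V_n^k:\ell_n(A)\ge1\}$.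 -}

module Defs where

open import Data.Bool using (Bool; true; false; _∧_; _∨_; not; if_then_else_; T)
open import Data.Nat using (ℕ; zero; suc; _+_; _*_; _∸_; _≤_; _≡ᵇ_; _≤ᵇ_; _/_)
open import Data.Nat.Properties using ()
open import Data.List using (List; map; upTo; _++_; foldr)
open import Data.Vec using (Vec; []; _∷_; tabulate)
open import Data.Fin using (toℕ)
open import Data.Fin.Subset using (Subset; ∣_∣; _∩_; Empty)
open import Data.Product using (_×_)
open import Relation.Nullary using (¬_)
open import Relation.Binary.PropositionalEquality using (_≡_)

-- Convention: A : Subset p represents a subset of [p] = {1,…,p};
-- position i (0-based) of the vector corresponds to the element i+1.

-- membership of a natural number m in A (false if m ∉ [p])
mem : ∀ {p} → Subset p → ℕ → Bool
mem [] _ = false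
mem (b ∷ A) zero = false
mem (b ∷ A) (suc zero) = b
mem (b ∷ A) (suc (suc m)) = mem A (suc m)

fromPred : (p : ℕ) → (ℕ → Bool) → Subset p
fromPred p q = tabulate (λ i → q (suc (toℕ i)))

IndepCycle : (p : ℕ) → Subset p → Set
IndepCycle p A =
  (∀ i → 1 ≤ i → suc i ≤ p → ¬ (T (mem A i ∧ mem A (suc i))))
  × (2 ≤ p → ¬ (T (mem A p ∧ mem A 1)))

V : (p j : ℕ) → Subset p → Set
V p j A = IndepCycle p A × ∣ A ∣ ≡ j

-- largest element of A (0 if A is empty)
maxFrom : ∀ {p} → Subset p → ℕ → ℕ
maxFrom A zero = zero
maxFrom A (suc m) = if mem A (suc m) then suc m else maxFrom A m

maxElem : ∀ {p} → Subset p → ℕ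
maxElem {p} A = maxFrom A p

core : ∀ {n} → Subset n → Subset n
core {n} A = fromPred n (λ j → mem A j ∧ not (if mem A 1 then j ≡ᵇ 1 else j ≡ᵇ maxElem A))

f : ∀ {n} → Subset n → Subset (n ∸ 2)
f {n} X = fromPred (n ∸ 2) (λ i → mem (core X) (suc i))

g : (n : ℕ) → Subset (n ∸ 2) → Subset n
g n Y = fromPred n (λ j → ((2 ≤ᵇ j) ∧ mem Y (j ∸ 1))
                          ∨ (if mem Y (n ∸ 2) then j ≡ᵇ 1 else j ≡ᵇ n))

oddNat : ℕ → Bool
oddNat zero = false
oddNat (suc m) = not (oddNat m)

Λ : ℕ → ℕ → List ℕ
Λ n i = if oddNat i
  then map (λ t → 2 + 2 * t) (upTo ((i ∸ 1) / 2))
       ++ map (λ t → (n + 1 ∸ i) + 2 * t) (upTo ((i + 1) / 2))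
  else map (λ t → 1 + 2 * t) (upTo (i / 2))
       ++ map (λ t → (n + 1 ∸ i) + 2 * t) (upTo (i / 2))

Λ⊆ : ∀ {n} → ℕ → Subset n → Bool
Λ⊆ {n} i A = foldr (λ m b → mem A m ∧ b) true (Λ n i)

-- largest i ≤ m with Λ_{n,i} ⊆ A (Λ_{n,0} = ∅, so 0 is always a candidate)
levelFrom : ∀ {n} → Subset n → ℕ → ℕ
levelFrom A zero = zero
levelFrom A (suc m) = if Λ⊆ (suc m) A then suc m else levelFrom A m

level : ∀ {n} → Subset n → ℕ
level {n} A = levelFrom A (n / 2)

V⁺ : (n k : ℕ) → Subset n → Set
V⁺ n k A = V n k A × 1 ≤ level A

Disjoint : ∀ {p} → Subset p → Subset p → Set
Disjoint X Y = Empty (X ∩ Y)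

module Submission where

-- Write n = m + 2 and call X ⊆ [n] anchored when it contains exactly one of 1 and n,
-- and contains n - 1 iff it contains 1.  Since Λ_{n,1} = {n}, Λ_{n,2} = {1, n - 1} and
-- every Λ_{n,i} with i ≥ 1 contains one of them, an independent X has level ≥ 1 iff
-- it is anchored.  On an anchored X the core drops exactly the chosen endpoint, so
-- f(X) is the shift {i ∈ [m] : i + 1 ∈ X}, and an anchored set is recovered from its
-- shift Y by 1 ∈ X ⇔ m ∈ Y; this recovery is g_n.  Independence transfers because the
-- cyclic pair (m, 1) of Y is the pair (1, 2) of X, the size drops by exactly one, and
-- disjointness is preserved because f(X) + 1 ⊆ X.

open import Defs
open import Data.Bool using (Bool; true; false; _∧_; _∨_; not; if_then_else_; T)
open import Data.Bool.Properties using (∧-identityʳ; ∨-identityʳ; ∧-inverseʳ; ∧-inverseˡ; ∧-conicalˡ; ∧-conicalʳ; not-involutive)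
open import Data.Empty using (⊥-elim)
open import Data.Fin using (toℕ) renaming (zero to fzero; suc to fsuc)
open import Data.Fin.Properties using (toℕ<n)
open import Data.Fin.Subset using (Subset; ∣_∣; _∈_; _∩_; Nonempty)
open import Data.List using (_∷_; foldr; map; upTo)
import Data.List.Membership.Propositional as List
open import Data.List.Membership.Propositional.Properties using (∈-map⁺; ∈-upTo⁺; ∈-++⁺ʳ)
import Data.List.Relation.Unary.Any as Any
open import Data.Nat using (ℕ; zero; suc; _+_; _*_; _∸_; _≤_; _<_; _≡ᵇ_; _≤ᵇ_; _/_; z≤n; s≤s)
open import Data.Nat.Properties
open import Data.Nat.DivMod using (/-congˡ; m*n/n≡m; m/n≡1+[m∸n]/n; m/n≤m; /-monoˡ-≤)
open import Data.Product using (Σ-syntax; _×_; _,_)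
open import Data.Sum using (inj₁; inj₂)
open import Data.Unit using (tt)
open import Function using (_∘′_)
open import Data.Vec.Base using ([]; _∷_; here; there)
open import Relation.Nullary using (¬_)
open import Relation.Binary.PropositionalEquality
  using (_≡_; refl; sym; trans; cong; cong₂; subst; module ≡-Reasoning)

open ≡-Reasoning

bit : Bool → ℕ
bit true = 1
bit false = 0

bit+bit-not : ∀ b c → bit b + (c + bit (not b)) ≡ suc c
bit+bit-not true c = cong suc (+-identityʳ c)
bit+bit-not false c = +-comm c 1

≡false⇒¬T : ∀ {a} → a ≡ false → ¬ T a
≡false⇒¬T refl ()

excludesʳ : ∀ {a b} → ¬ T (a ∧ b) → a ≡ true → b ≡ false
excludesʳ {b = true} apart refl = ⊥-elim (apart tt)
excludesʳ {b = false} _ _ = refl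

excludesˡ : ∀ {a b} → ¬ T (a ∧ b) → b ≡ true → a ≡ false
excludesˡ {true} apart refl = ⊥-elim (apart tt)
excludesˡ {false} _ _ = refl

<⇒≡ᵇ-false : ∀ {i j} → i < j → (i ≡ᵇ j) ≡ false
<⇒≡ᵇ-false {zero} {suc j} _ = refl
<⇒≡ᵇ-false {suc i} {suc j} (s≤s i<j) = <⇒≡ᵇ-false i<j

≡ᵇ-refl : ∀ i → (i ≡ᵇ i) ≡ true
≡ᵇ-refl zero = refl
≡ᵇ-refl (suc i) = ≡ᵇ-refl i

mem-∷ : ∀ {p} b (A : Subset p) j → 1 ≤ j → mem (b ∷ A) (suc j) ≡ mem A j
mem-∷ b A (suc j) _ = refl

mem-fromPred : ∀ p q j → 1 ≤ j → j ≤ p → mem (fromPred p q) j ≡ q j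
mem-fromPred (suc p) q (suc zero) _ _ = refl
mem-fromPred (suc p) q (suc (suc j)) _ (s≤s j≤p) =
  mem-fromPred p (λ i → q (suc i)) (suc j) (s≤s z≤n) j≤p

mem-beyond : ∀ {p} (A : Subset p) j → p < j → mem A j ≡ false
mem-beyond [] j _ = refl
mem-beyond (b ∷ A) (suc (suc j)) (s≤s p<j) = mem-beyond A (suc j) p<j

mem-ext : ∀ {p} (A B : Subset p) → (∀ j → 1 ≤ j → j ≤ p → mem A j ≡ mem B j) → A ≡ B
mem-ext [] [] _ = refl
mem-ext (a ∷ A) (b ∷ B) same = cong₂ _∷_ (same 1 (s≤s z≤n) (s≤s z≤n))
  (mem-ext A B λ j 1≤j j≤p → begin
    mem A j             ≡⟨ mem-∷ a A j 1≤j ⟨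
    mem (a ∷ A) (suc j) ≡⟨ same (suc j) (s≤s z≤n) (s≤s j≤p) ⟩
    mem (b ∷ B) (suc j) ≡⟨ mem-∷ b B j 1≤j ⟩
    mem B j             ∎)

mem-∩ : ∀ {p} (A B : Subset p) j → mem (A ∩ B) j ≡ (mem A j ∧ mem B j)
mem-∩ [] [] j = refl
mem-∩ (a ∷ A) (b ∷ B) zero = refl
mem-∩ (a ∷ A) (b ∷ B) (suc zero) = refl
mem-∩ (a ∷ A) (b ∷ B) (suc (suc j)) = mem-∩ A B (suc j)

∈⇒mem : ∀ {p} (A : Subset p) x → x ∈ A → mem A (suc (toℕ x)) ≡ true
∈⇒mem (_ ∷ A) fzero here = refl
∈⇒mem (_ ∷ A) (fsuc x) (there x∈A) = ∈⇒mem A x x∈A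

mem⇒nonempty : ∀ {p} (A : Subset p) j → mem A j ≡ true → Nonempty A
mem⇒nonempty (true ∷ A) (suc zero) refl = fzero , here
mem⇒nonempty (_ ∷ A) (suc (suc j)) j∈A with mem⇒nonempty A (suc j) j∈A
... | x , x∈A = fsuc x , there x∈A

count : (ℕ → Bool) → ℕ → ℕ
count q zero = 0
count q (suc p) = bit (q 1) + count (λ j → q (suc j)) p

count-cong : ∀ p q r → (∀ j → 1 ≤ j → j ≤ p → q j ≡ r j) → count q p ≡ count r p
count-cong zero q r _ = refl
count-cong (suc p) q r same = cong₂ _+_ (cong bit (same 1 (s≤s z≤n) (s≤s z≤n)))
  (count-cong p _ _ λ j _ j≤p → same (suc j) (s≤s z≤n) (s≤s j≤p))

count-snoc : ∀ p q → count q (suc p) ≡ count q p + bit (q (suc p))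
count-snoc zero q = +-comm (bit (q 1)) 0
count-snoc (suc p) q = trans (cong (bit (q 1) +_) (count-snoc p (λ j → q (suc j))))
  (sym (+-assoc (bit (q 1)) _ _))

∣∷∣ : ∀ {p} b (A : Subset p) → ∣ b ∷ A ∣ ≡ bit b + ∣ A ∣
∣∷∣ true A = refl
∣∷∣ false A = refl

∣∣≡count : ∀ {p} (A : Subset p) → ∣ A ∣ ≡ count (mem A) p
∣∣≡count [] = refl
∣∣≡count {suc p} (b ∷ A) = trans (∣∷∣ b A) (cong (bit b +_)
  (trans (∣∣≡count A) (count-cong p _ _ λ j 1≤j _ → sym (mem-∷ b A j 1≤j))))

-- Anchored sets and their shifts

data Position (m : ℕ) : ℕ → Set where
  first : Position m 1
  inner : ∀ i → 1 ≤ i → i ≤ m → Position m (suc i)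
  last  : Position m (suc (suc m))

position : ∀ m j → 1 ≤ j → j ≤ suc (suc m) → Position m j
position m (suc zero) _ _ = first
position m (suc (suc j)) _ (s≤s j<m+1) with m≤n⇒m<n∨m≡n j<m+1
... | inj₁ (s≤s j<m) = inner (suc j) (s≤s z≤n) j<m
... | inj₂ refl = last

Shifted : ∀ m → Subset (suc (suc m)) → Subset m → Set
Shifted m X Y = ∀ i → 1 ≤ i → i ≤ m → mem Y i ≡ mem X (suc i)

Anchored : ∀ m → Subset (suc (suc m)) → Set
Anchored m X = (mem X (suc m) ≡ mem X 1) × (mem X (suc (suc m)) ≡ not (mem X 1))

∣∣-anchored : ∀ m X Y → Anchored m X → Shifted m X Y → ∣ X ∣ ≡ suc ∣ Y ∣
∣∣-anchored m X Y (_ , lastX) shift = begin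
  ∣ X ∣
    ≡⟨ ∣∣≡count X ⟩
  bit (mem X 1) + count inside (suc m)
    ≡⟨ cong (bit (mem X 1) +_) (count-snoc m inside) ⟩
  bit (mem X 1) + (count inside m + bit (mem X (suc (suc m))))
    ≡⟨ cong₂ (λ c b → bit (mem X 1) + (c + bit b)) (count-cong m _ _ shift) (sym lastX) ⟨
  bit (mem X 1) + (count (mem Y) m + bit (not (mem X 1)))
    ≡⟨ bit+bit-not (mem X 1) _ ⟩
  suc (count (mem Y) m)
    ≡⟨ cong suc (∣∣≡count Y) ⟨
  suc ∣ Y ∣ ∎
  where
  inside : ℕ → Bool
  inside j = mem X (suc j)

shifted-indep : ∀ m X Y → Anchored m X → Shifted m X Y → IndepCycle (suc (suc m)) X → IndepCycle m Y
shifted-indep m X Y (penultX , _) shift (pathX , _) = path , cycle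
  where
  path : ∀ i → 1 ≤ i → suc i ≤ m → ¬ T (mem Y i ∧ mem Y (suc i))
  path i 1≤i i<m = pathX (suc i) (s≤s z≤n) (s≤s (m≤n⇒m≤1+n i<m))
    ∘′ subst T (cong₂ _∧_ (shift i 1≤i (<⇒≤ i<m)) (shift (suc i) (s≤s z≤n) i<m))
  cycle : 2 ≤ m → ¬ T (mem Y m ∧ mem Y 1)
  cycle 2≤m = pathX 1 (s≤s z≤n) (s≤s (s≤s z≤n))
    ∘′ subst T (cong₂ _∧_ (trans (shift m (≤-trans (s≤s z≤n) 2≤m) ≤-refl) penultX) (shift 1 (s≤s z≤n) (≤-trans (s≤s z≤n) 2≤m)))

-- For m = 1 the cycle condition on Y is vacuous, so separation of the ends is assumed.
unshifted-indep : ∀ m X Y → 1 ≤ m → Anchored m X → Shifted m X Y →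
  IndepCycle m Y → ¬ T (mem Y m ∧ mem Y 1) → IndepCycle (suc (suc m)) X
unshifted-indep m X Y 1≤m (penultX , lastX) shift (pathY , _) endsY = path , cycle
  where
  path : ∀ i → 1 ≤ i → suc i ≤ suc (suc m) → ¬ T (mem X i ∧ mem X (suc i))
  path i 1≤i i<n with position m i 1≤i (m≤n⇒m≤1+n (≤-pred i<n))
  ... | first = endsY ∘′ subst T (sym (cong₂ _∧_ (trans (shift m 1≤m ≤-refl) penultX) (shift 1 (s≤s z≤n) 1≤m)))
  ... | last = ⊥-elim (<-irrefl refl i<n)
  ... | inner j 1≤j j≤m with m≤n⇒m<n∨m≡n j≤m
  ...   | inj₁ j<m = pathY j 1≤j j<m ∘′ subst T (sym (cong₂ _∧_ (shift j 1≤j j≤m) (shift (suc j) (s≤s z≤n) j<m)))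
  ...   | inj₂ refl = ≡false⇒¬T (∧-inverseʳ (mem X 1)) ∘′ subst T (cong₂ _∧_ penultX lastX)
  cycle : 2 ≤ suc (suc m) → ¬ T (mem X (suc (suc m)) ∧ mem X 1)
  cycle _ = ≡false⇒¬T (∧-inverseˡ (mem X 1)) ∘′ subst T (cong (_∧ mem X 1) lastX)

shifted-unique : ∀ m X Y Y′ → Shifted m X Y → Shifted m X Y′ → Y ≡ Y′
shifted-unique m X Y Y′ shift shift′ =
  mem-ext Y Y′ λ i 1≤i i≤m → trans (shift i 1≤i i≤m) (sym (shift′ i 1≤i i≤m))

anchored-unique : ∀ m X X′ Y → 1 ≤ m → Anchored m X → Anchored m X′ →
  Shifted m X Y → Shifted m X′ Y → X ≡ X′
anchored-unique m X X′ Y 1≤m (penultX , lastX) (penultX′ , lastX′) shift shift′ =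
  mem-ext X X′ λ j 1≤j j≤n → same j (position m j 1≤j j≤n)
  where
  same-first : mem X 1 ≡ mem X′ 1
  same-first = begin
    mem X 1        ≡⟨ penultX ⟨
    mem X (suc m)  ≡⟨ shift m 1≤m ≤-refl ⟨
    mem Y m        ≡⟨ shift′ m 1≤m ≤-refl ⟩
    mem X′ (suc m) ≡⟨ penultX′ ⟩
    mem X′ 1       ∎
  same : ∀ j → Position m j → mem X j ≡ mem X′ j
  same _ first = same-first
  same _ (inner i 1≤i i≤m) = trans (sym (shift i 1≤i i≤m)) (shift′ i 1≤i i≤m)
  same _ last = trans lastX (trans (cong not same-first) (sym lastX′))

maxElem-last : ∀ m (X : Subset (suc (suc m))) → mem X (suc (suc m)) ≡ true → maxElem X ≡ suc (suc m)
maxElem-last m X n∈X rewrite n∈X = refl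

mem-f : ∀ m (X : Subset (suc (suc m))) i → 1 ≤ i → i ≤ m →
  mem (f X) i ≡ (mem X (suc i) ∧ not (if mem X 1 then suc i ≡ᵇ 1 else suc i ≡ᵇ maxElem X))
mem-f m X i 1≤i i≤m = trans (mem-fromPred m (λ i → mem (core X) (suc i)) i 1≤i i≤m)
  (mem-fromPred (suc (suc m)) (λ j → mem X j ∧ not (if mem X 1 then j ≡ᵇ 1 else j ≡ᵇ maxElem X))
    (suc i) (s≤s z≤n) (s≤s (m≤n⇒m≤1+n i≤m)))

f-⊆ : ∀ m (X : Subset (suc (suc m))) i → 1 ≤ i → i ≤ m → mem (f X) i ≡ true → mem X (suc i) ≡ true
f-⊆ m X i 1≤i i≤m i∈fX = ∧-conicalˡ _ _ (trans (sym (mem-f m X i 1≤i i≤m)) i∈fX)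

f-shifted : ∀ m X → Anchored m X → Shifted m X (f X)
f-shifted m X (_ , lastX) i@(suc _) 1≤i i≤m =
  trans (mem-f m X i 1≤i i≤m) (trans (cong (mem X (suc i) ∧_) (dropped (mem X 1) lastX)) (∧-identityʳ _))
  where
  dropped : ∀ b → mem X (suc (suc m)) ≡ not b → not (if b then suc i ≡ᵇ 1 else suc i ≡ᵇ maxElem X) ≡ true
  dropped true _ = refl
  dropped false n∈X rewrite maxElem-last m X n∈X | <⇒≡ᵇ-false (s≤s i≤m) = refl

mem-g : ∀ m (Y : Subset m) j → 1 ≤ j → j ≤ suc (suc m) →
  mem (g (suc (suc m)) Y) j ≡ (((2 ≤ᵇ j) ∧ mem Y (j ∸ 1)) ∨ (if mem Y m then j ≡ᵇ 1 else j ≡ᵇ suc (suc m)))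
mem-g m Y = mem-fromPred (suc (suc m))
  (λ j → ((2 ≤ᵇ j) ∧ mem Y (j ∸ 1)) ∨ (if mem Y m then j ≡ᵇ 1 else j ≡ᵇ suc (suc m)))

g-first : ∀ m (Y : Subset m) → mem (g (suc (suc m)) Y) 1 ≡ mem Y m
g-first m Y rewrite mem-g m Y 1 (s≤s z≤n) (s≤s z≤n) with mem Y m
... | true = refl
... | false = refl

g-shifted : ∀ m (Y : Subset m) → Shifted m (g (suc (suc m)) Y) Y
g-shifted m Y i@(suc _) 1≤i i≤m rewrite mem-g m Y (suc i) (s≤s z≤n) (s≤s (m≤n⇒m≤1+n i≤m)) with mem Y m
... | true = sym (∨-identityʳ _)
... | false rewrite <⇒≡ᵇ-false i≤m = sym (∨-identityʳ _)

g-last : ∀ m (Y : Subset m) → mem (g (suc (suc m)) Y) (suc (suc m)) ≡ not (mem Y m)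
g-last m Y rewrite mem-g m Y (suc (suc m)) (s≤s z≤n) ≤-refl | mem-beyond Y (suc m) ≤-refl with mem Y m
... | true = refl
... | false = ≡ᵇ-refl m

g-anchored : ∀ m (Y : Subset m) → 1 ≤ m → Anchored m (g (suc (suc m)) Y)
g-anchored m Y 1≤m =
  trans (sym (g-shifted m Y m 1≤m ≤-refl)) (sym (g-first m Y)) ,
  trans (g-last m Y) (cong not (sym (g-first m Y)))

-- The level

all-mem : ∀ {p} (A : Subset p) L x → foldr (λ j b → mem A j ∧ b) true L ≡ true → x List.∈ L → mem A x ≡ true
all-mem A (y ∷ L) x all (Any.here refl) = ∧-conicalˡ _ _ all
all-mem A (y ∷ L) x all (Any.there x∈L) = all-mem A L x (∧-conicalʳ _ _ all) x∈L

levelFrom-witness : ∀ {p} (A : Subset p) M → 1 ≤ levelFrom A M → Σ[ i ∈ ℕ ] 1 ≤ i × i ≤ M × Λ⊆ i A ≡ true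
levelFrom-witness A (suc M) 1≤ℓ with Λ⊆ (suc M) A in Λ⊆A
... | true = suc M , s≤s z≤n , ≤-refl , Λ⊆A
... | false with levelFrom-witness A M 1≤ℓ
...   | i , 1≤i , i≤M , Λᵢ⊆A = i , 1≤i , m≤n⇒m≤1+n i≤M , Λᵢ⊆A

levelFrom-≥1 : ∀ {p} (A : Subset p) M i → 1 ≤ i → i ≤ M → Λ⊆ i A ≡ true → 1 ≤ levelFrom A M
levelFrom-≥1 A zero (suc i) _ () _
levelFrom-≥1 A (suc M) i 1≤i i≤M Λᵢ⊆A with Λ⊆ (suc M) A in Λ⊆A
... | true = s≤s z≤n
... | false with m≤n⇒m<n∨m≡n i≤M
...   | inj₁ (s≤s i≤M′) = levelFrom-≥1 A M i 1≤i i≤M′ Λᵢ⊆A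
...   | inj₂ refl with trans (sym Λᵢ⊆A) Λ⊆A
...     | ()

data Parity : ℕ → Set where
  odd  : ∀ a → Parity (suc (2 * a))
  even : ∀ a → Parity (suc (suc (2 * a)))

parity : ∀ i → Parity (suc i)
parity zero = odd 0
parity (suc i) with parity i
... | odd a = even a
... | even a = subst Parity (cong suc (*-suc 2 a)) (odd (suc a))

oddNat-double : ∀ a → oddNat (2 * a) ≡ false
oddNat-double zero = refl
oddNat-double (suc a) = trans (cong oddNat (*-suc 2 a)) (trans (not-involutive _) (oddNat-double a))

half-double : ∀ a → (2 * a) / 2 ≡ a
half-double a = trans (/-congˡ {o = 2} (*-comm 2 a)) (m*n/n≡m a 2)

half-2+double : ∀ a → suc (suc (2 * a)) / 2 ≡ suc a
half-2+double a = trans (m/n≡1+[m∸n]/n {suc (suc (2 * a))} {2} (s≤s (s≤s z≤n))) (cong suc (half-double a))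

last∈Λ-odd : ∀ n a → 2 * a ≤ n → n List.∈ Λ n (suc (2 * a))
last∈Λ-odd n a 2a≤n rewrite oddNat-double a | +-comm (2 * a) 1 | half-2+double a =
  ∈-++⁺ʳ (map (λ t → 2 + 2 * t) (upTo ((suc (2 * a) ∸ 1) / 2)))
    (subst (List._∈ map (λ t → (n + 1 ∸ suc (2 * a)) + 2 * t) (upTo (suc a))) last≡n
      (∈-map⁺ (λ t → (n + 1 ∸ suc (2 * a)) + 2 * t) (∈-upTo⁺ (n<1+n a))))
  where
  last≡n : (n + 1 ∸ suc (2 * a)) + 2 * a ≡ n
  last≡n rewrite +-comm n 1 = m∸n+n≡m 2a≤n

first∈Λ-even : ∀ n a → 1 List.∈ Λ n (suc (suc (2 * a)))
first∈Λ-even n a rewrite oddNat-double a | half-2+double a = Any.here refl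

penult∈Λ-even : ∀ m a → 2 * a ≤ m → suc m List.∈ Λ (suc (suc m)) (suc (suc (2 * a)))
penult∈Λ-even m a 2a≤m rewrite oddNat-double a | half-2+double a =
  ∈-++⁺ʳ (map (λ t → 1 + 2 * t) (upTo (suc a)))
    (subst (List._∈ map (λ t → (suc (suc m) + 1 ∸ suc (suc (2 * a))) + 2 * t) (upTo (suc a))) penult≡m+1
      (∈-map⁺ (λ t → (suc (suc m) + 1 ∸ suc (suc (2 * a))) + 2 * t) (∈-upTo⁺ (n<1+n a))))
  where
  penult≡m+1 : (suc (suc m) + 1 ∸ suc (suc (2 * a))) + 2 * a ≡ suc m
  penult≡m+1 rewrite +-comm m 1 = m∸n+n≡m (m≤n⇒m≤1+n 2a≤m)

Λ₁⊆ : ∀ m (A : Subset (suc (suc m))) → mem A (suc (suc m)) ≡ true → Λ⊆ 1 A ≡ true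
Λ₁⊆ m A n∈A rewrite +-identityʳ (m + 1) | +-comm m 1 | n∈A = refl

Λ₂⊆ : ∀ m (A : Subset (suc (suc m))) → mem A 1 ≡ true → mem A (suc m) ≡ true → Λ⊆ 2 A ≡ true
Λ₂⊆ m A 1∈A n-1∈A rewrite +-identityʳ (m + 1) | +-comm m 1 | 1∈A | n-1∈A = refl

level≥1⇒anchored : ∀ m X → IndepCycle (suc (suc m)) X → 1 ≤ level X → Anchored m X
level≥1⇒anchored m X (pathX , cycleX) 1≤ℓ
  with levelFrom-witness X (suc (suc m) / 2) 1≤ℓ
... | i@(suc i′) , _ , i≤n/2 , Λᵢ⊆X with parity i′
...   | odd a = trans m+1∉X (sym 1∉X) , trans n∈X (cong not (sym 1∉X))
  where
  n∈X : mem X (suc (suc m)) ≡ true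
  n∈X = all-mem X (Λ (suc (suc m)) i) _ Λᵢ⊆X (last∈Λ-odd (suc (suc m)) a (≤-trans (n≤1+n (2 * a)) (≤-trans i≤n/2 (m/n≤m _ 2))))
  1∉X : mem X 1 ≡ false
  1∉X = excludesʳ (cycleX (s≤s (s≤s z≤n))) n∈X
  m+1∉X : mem X (suc m) ≡ false
  m+1∉X = excludesˡ (pathX (suc m) (s≤s z≤n) ≤-refl) n∈X
...   | even a = trans m+1∈X (sym 1∈X) , trans n∉X (cong not (sym 1∈X))
  where
  2a≤m : 2 * a ≤ m
  2a≤m = ≤-pred (≤-pred (≤-trans i≤n/2 (m/n≤m _ 2)))
  1∈X : mem X 1 ≡ true
  1∈X = all-mem X (Λ (suc (suc m)) i) _ Λᵢ⊆X (first∈Λ-even (suc (suc m)) a)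
  m+1∈X : mem X (suc m) ≡ true
  m+1∈X = all-mem X (Λ (suc (suc m)) i) _ Λᵢ⊆X (penult∈Λ-even m a 2a≤m)
  n∉X : mem X (suc (suc m)) ≡ false
  n∉X = excludesˡ (cycleX (s≤s (s≤s z≤n))) 1∈X

anchored⇒level≥1 : ∀ m X → 1 ≤ m → IndepCycle (suc (suc m)) X → Anchored m X → 1 ≤ level X
anchored⇒level≥1 m X 1≤m (pathX , _) (penultX , lastX) with mem X 1 in 1∈X
... | true = levelFrom-≥1 X _ 2 (s≤s z≤n) (/-monoˡ-≤ 2 (s≤s (s≤s 2≤m))) (Λ₂⊆ m X 1∈X penultX)
  where
  2≤m : 2 ≤ m
  2≤m = ≤∧≢⇒< 1≤m λ m≡1 → pathX 1 (s≤s z≤n) (s≤s (s≤s z≤n))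
    (subst T (sym (cong₂ _∧_ 1∈X (subst (λ j → mem X (suc j) ≡ true) (sym m≡1) penultX))) tt)
... | false = levelFrom-≥1 X _ 1 (s≤s z≤n) (/-monoˡ-≤ 2 (s≤s (s≤s (z≤n {m})))) (Λ₁⊆ m X lastX)

-- For m = 1 only k = 1 meets the bound, so Y is empty.
ends-apart : ∀ k m (Y : Subset m) → 2 * k + 1 ≤ suc (suc m) → V m (k ∸ 1) Y → ¬ T (mem Y m ∧ mem Y 1)
ends-apart k zero [] _ _ ()
ends-apart k (suc (suc m)) Y _ ((_ , cycleY) , _) = cycleY (s≤s (s≤s z≤n))
ends-apart (suc (suc k)) (suc zero) Y bound _ _ = 5≰3 (≤-trans (+-monoˡ-≤ 1 (*-monoʳ-≤ 2 (s≤s (s≤s (z≤n {k}))))) bound)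
  where
  5≰3 : ¬ 5 ≤ 3
  5≰3 (s≤s (s≤s (s≤s ())))
ends-apart zero (suc zero) (true ∷ []) _ (_ , ()) _
ends-apart (suc zero) (suc zero) (true ∷ []) _ (_ , ()) _
ends-apart _ (suc zero) (false ∷ []) _ _ ()

f∈V : ∀ k m X → V⁺ (suc (suc m)) k X → V m (k ∸ 1) (f X)
f∈V k m X ((indepX , ∣X∣≡k) , 1≤ℓ) =
  shifted-indep m X (f X) anchored shifted indepX ,
  cong (_∸ 1) (trans (sym (∣∣-anchored m X (f X) anchored shifted)) ∣X∣≡k)
  where
  anchored : Anchored m X
  anchored = level≥1⇒anchored m X indepX 1≤ℓ
  shifted : Shifted m X (f X)
  shifted = f-shifted m X anchored

g∈V⁺ : ∀ k m Y → 1 ≤ k → 2 * k + 1 ≤ suc (suc m) → 1 ≤ m → V m (k ∸ 1) Y → V⁺ (suc (suc m)) k (g (suc (suc m)) Y)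
g∈V⁺ k m Y 1≤k bound 1≤m (indepY , ∣Y∣≡k-1) =
  (indepG , trans (∣∣-anchored m G Y anchored shifted) (trans (cong suc ∣Y∣≡k-1) (m+[n∸m]≡n 1≤k))) ,
  anchored⇒level≥1 m G 1≤m indepG anchored
  where
  G : Subset (suc (suc m))
  G = g (suc (suc m)) Y
  anchored : Anchored m G
  anchored = g-anchored m Y 1≤m
  shifted : Shifted m G Y
  shifted = g-shifted m Y
  indepG : IndepCycle (suc (suc m)) G
  indepG = unshifted-indep m G Y 1≤m anchored shifted indepY (ends-apart k m Y bound (indepY , ∣Y∣≡k-1))

g∘f≡id : ∀ k m X → 1 ≤ m → V⁺ (suc (suc m)) k X → g (suc (suc m)) (f X) ≡ X
g∘f≡id k m X 1≤m ((indepX , _) , 1≤ℓ) =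
  anchored-unique m (g (suc (suc m)) (f X)) X (f X) 1≤m
    (g-anchored m (f X) 1≤m) anchored (g-shifted m (f X)) (f-shifted m X anchored)
  where
  anchored : Anchored m X
  anchored = level≥1⇒anchored m X indepX 1≤ℓ

f∘g≡id : ∀ m Y → 1 ≤ m → f (g (suc (suc m)) Y) ≡ Y
f∘g≡id m Y 1≤m =
  shifted-unique m G (f G) Y (f-shifted m G (g-anchored m Y 1≤m)) (g-shifted m Y)
  where
  G : Subset (suc (suc m))
  G = g (suc (suc m)) Y

f-disjoint : ∀ m (X Y : Subset (suc (suc m))) → Disjoint X Y → Disjoint (f X) (f Y)
f-disjoint m X Y X∩Y≡∅ (x , x∈fX∩fY) = X∩Y≡∅ (mem⇒nonempty (X ∩ Y) (suc i)
  (trans (mem-∩ X Y (suc i)) (cong₂ _∧_ (f-⊆ m X i (s≤s z≤n) (toℕ<n x) (∧-conicalˡ _ _ i∈fX∩fY))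
                                         (f-⊆ m Y i (s≤s z≤n) (toℕ<n x) (∧-conicalʳ _ _ i∈fX∩fY)))))
  where
  i : ℕ
  i = suc (toℕ x)
  i∈fX∩fY : (mem (f X) i ∧ mem (f Y) i) ≡ true
  i∈fX∩fY = trans (sym (mem-∩ (f X) (f Y) i)) (∈⇒mem (f X ∩ f Y) x x∈fX∩fY)

lemma3p4 : (k n : ℕ) → 1 ≤ k → 2 * k + 1 ≤ n →
    ((X : Subset n) → V⁺ n k X → V (n ∸ 2) (k ∸ 1) (f X))
    × ((Y : Subset (n ∸ 2)) → V (n ∸ 2) (k ∸ 1) Y → V⁺ n k (g n Y))
    × ((X : Subset n) → V⁺ n k X → g n (f X) ≡ X)
    × ((Y : Subset (n ∸ 2)) → V (n ∸ 2) (k ∸ 1) Y → f (g n Y) ≡ Y)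
    × ((X Y : Subset n) → V n k X → V n k Y → Disjoint X Y → Disjoint (f X) (f Y))
lemma3p4 k n 1≤k bound with ≤-trans (+-monoˡ-≤ 1 (*-monoʳ-≤ 2 1≤k)) bound
... | s≤s (s≤s (s≤s {n = m} _)) =
  (λ X → f∈V k (suc m) X) ,
  (λ Y → g∈V⁺ k (suc m) Y 1≤k bound 1≤m) ,
  (λ X → g∘f≡id k (suc m) X 1≤m) ,
  (λ Y _ → f∘g≡id (suc m) Y 1≤m) ,
  (λ X Y _ _ → f-disjoint (suc m) X Y)
  where
  1≤m : 1 ≤ suc m
  1≤m = s≤s z≤n
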